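{- Let $\Phi$ be a domain with $|\Phi|=n$, and let $\Sigma=\{\wedge,\veebar,\vee\}$ or $\Sigma=\{\wedge,\veebar,\mathbin{\dot\vee}\}$. Then the class of $\Phi$-teams of odd cardinality is definable by a $\mathrm{PL}(\Sigma)$-formula of length $2^{O(n)}$, and so is the class of $\Phi$-teams of even cardinality (a formula $\varphi$ defines a class $P$ of $\Phi$-teams if for every $\Phi$-team $T$: $T\models\varphi$ iff $T\in P$).
   Context: A domain $\Phi$ is a finite set of propositional variables; a $\Phi$-assignment is a map $s:\Phi\to\{0,1\}$; a $\Phi$-team is a (possibly empty) set of $\Phi$-assignments. A split of $T$ is $(T_1,T_2)$ with $T_1,T_2\subseteq T$, $T_1\cup T_2=T$; strict if $T_1\cap T_2=\emptyset$. $\mathrm{PL}(\Sigma)$ is the set of formulas built from the literals $\top,\bot,{\sim}\top,{\sim}\bot,p,\neg p,{\sim}p,{\sim}\neg p$ ($p\in\Phi$) by the connectives in $\Sigma$. Semantics: $T\models\top$ always; $T\models\bot$ iff $T=\emptyset$; $T\models p$ iff $s(p)=1$ for all $s\in T$; $T\models\neg p$ iff $s(p)=0$ for all $s\in T$; $T\models{\sim}\ell$ iff $T\not\models\ell$ for a literal $\ell$; $\wedge$ is conjunction; $T\models\psi\veebar\theta$ iff $T\models\psi$ or $T\models\theta$; $T\models\psi\vee\theta$ iff some split $(S,U)$ has $S\models\psi$, $U\models\theta$; $\mathbin{\dot\vee}$ likewise with strict splits. Length = length as a string, each variable counting as one symbol. -}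

module Defs where

open import Data.Nat using (ℕ; zero; suc; _+_; _*_; _^_; _≤_; _%_)
open import Data.Bool using (Bool; true; false)
open import Data.Fin using (Fin)
open import Data.Vec using (Vec; []; _∷_; lookup)
open import Data.List using (List; []; _∷_; map; _++_; filter; length)
open import Data.Product using (Σ; ∃; _×_; _,_)
open import Data.Sum using (_⊎_)
open import Data.Empty using (⊥)
open import Data.Unit using (⊤)
open import Relation.Nullary using (¬_)
open import Relation.Binary.PropositionalEquality using (_≡_)

-- Domain Φ = Fin n (|Φ| = n). A Φ-assignment is a vector of n bits
-- (s(p_i) = lookup s i).
Assignment : ℕ → Set
Assignment n = Vec Bool n

Team : ℕ → Set
Team n = Assignment n → Bool

-- list of all Φ-assignments (each exactly once)
allAssignments : (n : ℕ) → List (Assignment n)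
allAssignments zero = [] ∷ []
allAssignments (suc n) = map (true ∷_) (allAssignments n) ++ map (false ∷_) (allAssignments n)

countTrue : ∀ {n} → Team n → List (Assignment n) → ℕ
countTrue T [] = 0
countTrue T (s ∷ ss) with T s
... | true  = suc (countTrue T ss)
... | false = countTrue T ss

card : ∀ {n} → Team n → ℕ
card {n} T = countTrue T (allAssignments n)

IsSplit : ∀ {n} → Team n → Team n → Team n → Set
IsSplit {n} T T₁ T₂ =
  (∀ s → T₁ s ≡ true → T s ≡ true) ×
  (∀ s → T₂ s ≡ true → T s ≡ true) ×
  (∀ s → T s ≡ true → T₁ s ≡ true ⊎ T₂ s ≡ true)

IsStrictSplit : ∀ {n} → Team n → Team n → Team n → Set
IsStrictSplit {n} T T₁ T₂ =
  IsSplit T T₁ T₂ × (∀ s → T₁ s ≡ true → T₂ s ≡ true → ⊥)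

data Atom (n : ℕ) : Set where
  top bot : Atom n
  pos neg : Fin n → Atom n

data Literal (n : ℕ) : Set where
  plain : Atom n → Literal n
  tilde : Atom n → Literal n

data Formula (n : ℕ) : Set where
  lit    : Literal n → Formula n
  _∧'_   : Formula n → Formula n → Formula n
  _⊻'_   : Formula n → Formula n → Formula n
  _∨'_   : Formula n → Formula n → Formula n
  _∨̇'_   : Formula n → Formula n → Formula n

-- The two connective sets of the theorem:
--   laxΣ   = {∧, ⊻, ∨}
--   strictΣ = {∧, ⊻, ∨̇}
data Sig : Set where
  laxΣ strictΣ : Sig

InPL : ∀ {n} → Sig → Formula n → Set
InPL σ (lit l) = ⊤
InPL σ (φ ∧' ψ) = InPL σ φ × InPL σ ψ
InPL σ (φ ⊻' ψ) = InPL σ φ × InPL σ ψ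
InPL laxΣ (φ ∨' ψ) = InPL laxΣ φ × InPL laxΣ ψ
InPL strictΣ (φ ∨' ψ) = ⊥
InPL laxΣ (φ ∨̇' ψ) = ⊥
InPL strictΣ (φ ∨̇' ψ) = InPL strictΣ φ × InPL strictΣ ψ

_⊨ᵃ_ : ∀ {n} → Team n → Atom n → Set
T ⊨ᵃ top = ⊤
T ⊨ᵃ bot = ∀ s → T s ≡ false
T ⊨ᵃ pos i = ∀ s → T s ≡ true → lookup s i ≡ true
T ⊨ᵃ neg i = ∀ s → T s ≡ true → lookup s i ≡ false

_⊨ˡ_ : ∀ {n} → Team n → Literal n → Set
T ⊨ˡ plain a = T ⊨ᵃ a
T ⊨ˡ tilde a = ¬ (T ⊨ᵃ a)

_⊨_ : ∀ {n} → Team n → Formula n → Set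
T ⊨ lit l = T ⊨ˡ l
T ⊨ (φ ∧' ψ) = T ⊨ φ × T ⊨ ψ
T ⊨ (φ ⊻' ψ) = T ⊨ φ ⊎ T ⊨ ψ
T ⊨ (φ ∨' ψ) = Σ (Team _) λ S → Σ (Team _) λ U → IsSplit T S U × S ⊨ φ × U ⊨ ψ
T ⊨ (φ ∨̇' ψ) = Σ (Team _) λ S → Σ (Team _) λ U → IsStrictSplit T S U × S ⊨ φ × U ⊨ ψ

-- Length as a string (fully parenthesised binary connectives, each
-- variable one symbol): ⊤,⊥,p : 1; ∼⊤,∼⊥,¬p,∼p : 2; ∼¬p : 3; (φ∘ψ) : |φ|+|ψ|+3.
atomLen : ∀ {n} → Atom n → ℕ
atomLen top = 1
atomLen bot = 1
atomLen (pos i) = 1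
atomLen (neg i) = 2

litLen : ∀ {n} → Literal n → ℕ
litLen (plain a) = atomLen a
litLen (tilde a) = suc (atomLen a)

len : ∀ {n} → Formula n → ℕ
len (lit l) = litLen l
len (φ ∧' ψ) = len φ + len ψ + 3
len (φ ⊻' ψ) = len φ + len ψ + 3
len (φ ∨' ψ) = len φ + len ψ + 3
len (φ ∨̇' ψ) = len φ + len ψ + 3

Defines : ∀ {n} → Formula n → (Team n → Set) → Set
Defines {n} φ P = ∀ (T : Team n) → (T ⊨ φ → P T) × (P T → T ⊨ φ)

OddCard : ∀ {n} → Team n → Set
OddCard T = card T % 2 ≡ 1

EvenCard : ∀ {n} → Team n → Set
EvenCard T = card T % 2 ≡ 0

{-# OPTIONS --safe #-}
-- Split a team T over p₀,…,pₙ by the value of p₀ into T ↾ true and T ↾ false. With A and B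
-- reindexed to p₁,…,pₙ, the formula (p₀ ∧ A) ∨ (¬p₀ ∧ B) holds in T iff A holds in T ↾ true and
-- B in T ↾ false, for lax and strict splits alike. Since |T| = |T ↾ true| + |T ↾ false|, |T| has
-- parity b iff the halves have parities c and c xor b for some c; this defines the parity
-- formulas by recursion on n. Each level uses four formulas of the previous one, so the length
-- is O(4ⁿ) = 2^O(n).
module Submission where

open import Defs
open import Data.Nat using (ℕ; zero; suc; _+_; _*_; _^_; _≤_; _%_)
open import Data.Nat.Properties using (m+n≤o⇒m≤o; ≤-trans; ≤-reflexive; ≤-refl; n≤1+n; +-mono-≤; ^-*-assoc; module ≤-Reasoning)
open import Data.Nat.Tactic.RingSolver using (solve-∀)
open import Data.Bool using (Bool; true; false; not; _∧_; _xor_; if_then_else_)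
open import Data.Bool.Properties using (not-involutive; not-distribˡ-xor; ¬-not; not-¬; ⇔→≡)
open import Data.Fin using () renaming (zero to fzero; suc to fsuc)
open import Data.Vec using ([]; _∷_; lookup)
open import Data.List using (List; []; _∷_; map; _++_)
open import Data.Product using (Σ; _×_; _,_; proj₁; proj₂; uncurry)
open import Data.Sum using (_⊎_; inj₁; inj₂; [_,_]′; swap)
open import Data.Sum.Function.Propositional using (_⊎-⇔_)
open import Data.Product.Function.NonDependent.Propositional using (_×-⇔_)
open import Data.Empty using (⊥; ⊥-elim)
open import Data.Unit using (tt)
open import Level using (0ℓ)
open import Function.Bundles using (_⇔_; mk⇔; Equivalence)
open import Function.Properties.Equivalence using (⇔-setoid)
import Relation.Binary.Reasoning.Setoid as ≈-Reasoning
open import Function.Related.TypeIsomorphisms using (¬-cong-⇔)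
open import Function.Base using (id; _∘_)
open import Relation.Binary.PropositionalEquality using (_≡_; refl; sym; trans; cong; cong₂)

open Equivalence using (to; from)

private
  variable
    n : ℕ
    b : Bool

infix 4 _⊆_ _≐_

_⊆_ : Team n → Team n → Set
S ⊆ T = ∀ s → S s ≡ true → T s ≡ true

_≐_ : Team n → Team n → Set
T ≐ T' = ∀ s → T s ≡ T' s

Disjoint : Team n → Team n → Set
Disjoint S U = ∀ s → S s ≡ true → U s ≡ true → ⊥

≐-sym : {T T' : Team n} → T ≐ T' → T' ≐ T
≐-sym e s = sym (e s)

IsSplit-swap : {T S U : Team n} → IsSplit T S U → IsSplit T U S
IsSplit-swap (S⊆T , U⊆T , cover) = U⊆T , S⊆T , (λ s → swap ∘ cover s)

⊨ᵃ-resp-≐ : {T T' : Team n} (a : Atom n) → T ≐ T' → T ⊨ᵃ a → T' ⊨ᵃ a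
⊨ᵃ-resp-≐ top     e h     = tt
⊨ᵃ-resp-≐ bot     e h s   = trans (sym (e s)) (h s)
⊨ᵃ-resp-≐ (pos i) e h s t = h s (trans (e s) t)
⊨ᵃ-resp-≐ (neg i) e h s t = h s (trans (e s) t)

IsSplit-resp-≐ : {T T' S U : Team n} → T ≐ T' → IsSplit T S U → IsSplit T' S U
IsSplit-resp-≐ e (S⊆T , U⊆T , cover) =
  (λ s t → trans (sym (e s)) (S⊆T s t)) , (λ s t → trans (sym (e s)) (U⊆T s t)) , (λ s t → cover s (trans (e s) t))

⊨-resp-≐ : {T T' : Team n} (φ : Formula n) → T ≐ T' → T ⊨ φ → T' ⊨ φ
⊨-resp-≐ (lit (plain a)) e h                  = ⊨ᵃ-resp-≐ a e h
⊨-resp-≐ (lit (tilde a)) e h h'               = h (⊨ᵃ-resp-≐ a (≐-sym e) h')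
⊨-resp-≐ (φ ∧' ψ) e (h₁ , h₂)                 = ⊨-resp-≐ φ e h₁ , ⊨-resp-≐ ψ e h₂
⊨-resp-≐ (φ ⊻' ψ) e (inj₁ h)                  = inj₁ (⊨-resp-≐ φ e h)
⊨-resp-≐ (φ ⊻' ψ) e (inj₂ h)                  = inj₂ (⊨-resp-≐ ψ e h)
⊨-resp-≐ (φ ∨' ψ) e (S , U , sp , h)          = S , U , IsSplit-resp-≐ e sp , h
⊨-resp-≐ (φ ∨̇' ψ) e (S , U , (sp , d) , h) = S , U , (IsSplit-resp-≐ e sp , d) , h

∧-≡-true : ∀ {x y} → x ∧ y ≡ true → x ≡ true × y ≡ true
∧-≡-true {true} t = refl , t

∧-intro : ∀ {x y} → x ≡ true → y ≡ true → x ∧ y ≡ true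
∧-intro refl t = t

infixl 30 _↾_ _↑_

_↾_ : Team (suc n) → Bool → Team n
(T ↾ b) s = T (b ∷ s)

Headed : Bool → Team (suc n) → Set
Headed b S = ∀ s → S s ≡ true → lookup s fzero ≡ b

Headed-⊆ : {S T : Team (suc n)} → S ⊆ T → Headed b T → Headed b S
Headed-⊆ S⊆T hT s t = hT s (S⊆T s t)

Headed-∀ : {S : Team (suc n)} {P : _ → Set} → Headed b S →
           (∀ s → S (b ∷ s) ≡ true → P (b ∷ s)) → ∀ s → S s ≡ true → P s
Headed-∀ hS h (c ∷ s) t with hS (c ∷ s) t
... | refl = h s t

Headed-excludes : {S : Team (suc n)} → Headed b S → ∀ s → S (not b ∷ s) ≡ true → ⊥
Headed-excludes {b = b} hS s t = not-¬ refl (sym (hS (not b ∷ s) t))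

↾-split : {T S U : Team (suc n)} → IsSplit T S U → IsSplit (T ↾ b) (S ↾ b) (U ↾ b)
↾-split {b = b} (S⊆T , U⊆T , cover) = (λ s → S⊆T (b ∷ s)) , (λ s → U⊆T (b ∷ s)) , (λ s → cover (b ∷ s))

↾-disjoint : {S U : Team (suc n)} → Disjoint S U → Disjoint (S ↾ b) (U ↾ b)
↾-disjoint {b = b} d s = d (b ∷ s)

↾-absorbs : {T S U : Team (suc n)} → IsSplit T S U → (∀ s → U (b ∷ s) ≡ true → ⊥) → S ↾ b ≐ T ↾ b
↾-absorbs {b = b} (S⊆T , _ , cover) U↾b-empty s = ⇔→≡ {z = true}
  (mk⇔ (S⊆T (b ∷ s)) (λ t → [ id , ⊥-elim ∘ U↾b-empty s ]′ (cover (b ∷ s) t)))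

_↑_ : Team (suc n) → Team n → Team (suc n)
(S ↑ V) (c ∷ s) = V s ∧ S (c ∷ s)

↑-⊆ : (S : Team (suc n)) (V : Team n) → S ↑ V ⊆ S
↑-⊆ S V (c ∷ s) t = proj₂ (∧-≡-true {V s} t)

↑-↾ : {S : Team (suc n)} {V : Team n} → V ⊆ S ↾ b → (S ↑ V) ↾ b ≐ V
↑-↾ {V = V} V⊆S s with V s in t
... | true  = V⊆S s t
... | false = refl

↑-split : {S : Team (suc n)} {V₁ V₂ : Team n} → Headed b S → IsSplit (S ↾ b) V₁ V₂ →
          IsSplit S (S ↑ V₁) (S ↑ V₂)
↑-split {S = S} {V₁} {V₂} hS (_ , _ , cover) = ↑-⊆ S V₁ , ↑-⊆ S V₂ , Headed-∀ hS lift-cover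
  where
  lift-cover : ∀ s → S (_ ∷ s) ≡ true → (S ↑ V₁) (_ ∷ s) ≡ true ⊎ (S ↑ V₂) (_ ∷ s) ≡ true
  lift-cover s t with cover s t
  ... | inj₁ t₁ = inj₁ (∧-intro t₁ t)
  ... | inj₂ t₂ = inj₂ (∧-intro t₂ t)

↑-disjoint : (S : Team (suc n)) {V₁ V₂ : Team n} → Disjoint V₁ V₂ → Disjoint (S ↑ V₁) (S ↑ V₂)
↑-disjoint S {V₁} {V₂} d (c ∷ s) t₁ t₂ = d s (proj₁ (∧-≡-true {V₁ s} t₁)) (proj₁ (∧-≡-true {V₂ s} t₂))

shiftᵃ : Atom n → Atom (suc n)
shiftᵃ top     = top
shiftᵃ bot     = bot
shiftᵃ (pos i) = pos (fsuc i)
shiftᵃ (neg i) = neg (fsuc i)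

shift : Formula n → Formula (suc n)
shift (lit (plain a)) = lit (plain (shiftᵃ a))
shift (lit (tilde a)) = lit (tilde (shiftᵃ a))
shift (φ ∧' ψ)        = shift φ ∧' shift ψ
shift (φ ⊻' ψ)        = shift φ ⊻' shift ψ
shift (φ ∨' ψ)        = shift φ ∨' shift ψ
shift (φ ∨̇' ψ)        = shift φ ∨̇' shift ψ

⊨ᵃ-shift : {S : Team (suc n)} (a : Atom n) → Headed b S → S ⊨ᵃ shiftᵃ a ⇔ S ↾ b ⊨ᵃ a
⊨ᵃ-shift top     hS = mk⇔ (λ _ → tt) (λ _ → tt)
⊨ᵃ-shift bot     hS = mk⇔ (λ h s → h (_ ∷ s))
  (λ h s → ¬-not (Headed-∀ {P = λ _ → ⊥} hS (λ s t → not-¬ refl (trans (sym t) (h s))) s))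
⊨ᵃ-shift {b = b} (pos i) hS = mk⇔ (λ h s → h (b ∷ s)) (Headed-∀ hS)
⊨ᵃ-shift {b = b} (neg i) hS = mk⇔ (λ h s → h (b ∷ s)) (Headed-∀ hS)

-- Splits of a team whose assignments all have p₀ = b are restricted part by part with ↾, and
-- splits of its restriction are lifted back with ↑.
⊨-shift : {S : Team (suc n)} (φ : Formula n) → Headed b S → S ⊨ shift φ ⇔ S ↾ b ⊨ φ

⊨-shift-⊆ : {S U : Team (suc n)} (φ : Formula n) → Headed b S → U ⊆ S → U ⊨ shift φ → U ↾ b ⊨ φ
⊨-shift-⊆ φ hS U⊆S = to (⊨-shift φ (Headed-⊆ U⊆S hS))

⊨-shift-↑ : {S : Team (suc n)} {V : Team n} (φ : Formula n) → Headed b S → V ⊆ S ↾ b →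
            V ⊨ φ → S ↑ V ⊨ shift φ
⊨-shift-↑ {b = b} {S = S} {V} φ hS V⊆S h =
  from (⊨-shift φ (Headed-⊆ (↑-⊆ S V) hS)) (⊨-resp-≐ φ (≐-sym (↑-↾ {b = b} {S = S} V⊆S)) h)

⊨-shift (lit (plain a)) hS = ⊨ᵃ-shift a hS
⊨-shift (lit (tilde a)) hS = ¬-cong-⇔ (⊨ᵃ-shift a hS)
⊨-shift (φ ∧' ψ) hS = ⊨-shift φ hS ×-⇔ ⊨-shift ψ hS
⊨-shift (φ ⊻' ψ) hS = ⊨-shift φ hS ⊎-⇔ ⊨-shift ψ hS
⊨-shift {S = S} (φ ∨' ψ) hS = mk⇔
  (λ (U₁ , U₂ , sp@(U₁⊆ , U₂⊆ , _) , h₁ , h₂) →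
     U₁ ↾ _ , U₂ ↾ _ , ↾-split sp , ⊨-shift-⊆ φ hS U₁⊆ h₁ , ⊨-shift-⊆ ψ hS U₂⊆ h₂)
  (λ (V₁ , V₂ , sp@(V₁⊆ , V₂⊆ , _) , h₁ , h₂) →
     S ↑ V₁ , S ↑ V₂ , ↑-split hS sp , ⊨-shift-↑ φ hS V₁⊆ h₁ , ⊨-shift-↑ ψ hS V₂⊆ h₂)
⊨-shift {S = S} (φ ∨̇' ψ) hS = mk⇔
  (λ (U₁ , U₂ , (sp@(U₁⊆ , U₂⊆ , _) , d) , h₁ , h₂) →
     U₁ ↾ _ , U₂ ↾ _ , (↾-split sp , ↾-disjoint d) , ⊨-shift-⊆ φ hS U₁⊆ h₁ , ⊨-shift-⊆ ψ hS U₂⊆ h₂)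
  (λ (V₁ , V₂ , (sp@(V₁⊆ , V₂⊆ , _) , d) , h₁ , h₂) →
     S ↑ V₁ , S ↑ V₂ , (↑-split hS sp , ↑-disjoint S d) , ⊨-shift-↑ φ hS V₁⊆ h₁ , ⊨-shift-↑ ψ hS V₂⊆ h₂)

_∩head_ : Team (suc n) → Bool → Team (suc n)
(T ∩head true)  (c ∷ s) = c ∧ T (c ∷ s)
(T ∩head false) (c ∷ s) = not c ∧ T (c ∷ s)

∩head-headed : (T : Team (suc n)) (b : Bool) → Headed b (T ∩head b)
∩head-headed T true  (true  ∷ s) t = refl
∩head-headed T false (false ∷ s) t = refl

∩head-strictSplit : (T : Team (suc n)) → IsStrictSplit T (T ∩head true) (T ∩head false)
∩head-strictSplit T = (true⊆T , false⊆T , cover) , disjoint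
  where
  true⊆T : T ∩head true ⊆ T
  true⊆T (true ∷ s) t = t
  false⊆T : T ∩head false ⊆ T
  false⊆T (false ∷ s) t = t
  cover : ∀ s → T s ≡ true → (T ∩head true) s ≡ true ⊎ (T ∩head false) s ≡ true
  cover (true  ∷ s) t = inj₁ t
  cover (false ∷ s) t = inj₂ t
  disjoint : Disjoint (T ∩head true) (T ∩head false)
  disjoint (true  ∷ s) _ ()
  disjoint (false ∷ s) ()

headAtom : Bool → Atom (suc n)
headAtom true  = pos fzero
headAtom false = neg fzero

branch : Bool → Formula n → Formula (suc n)
branch b A = lit (plain (headAtom b)) ∧' shift A

branches-⊨ : {T : Team (suc n)} (A B : Formula n) →
             T ⊨ (branch true A ∨' branch false B) → T ↾ true ⊨ A × T ↾ false ⊨ B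
branches-⊨ A B (S , U , sp , (hS , SA) , (hU , UB)) =
  ⊨-resp-≐ A (↾-absorbs sp (Headed-excludes hU)) (to (⊨-shift A hS) SA) ,
  ⊨-resp-≐ B (↾-absorbs (IsSplit-swap sp) (Headed-excludes hS)) (to (⊨-shift B hU) UB)

⊨-branches : {T : Team (suc n)} (A B : Formula n) →
             T ↾ true ⊨ A → T ↾ false ⊨ B → T ⊨ (branch true A ∨̇' branch false B)
⊨-branches {T = T} A B TA TB =
  T ∩head true , T ∩head false , ∩head-strictSplit T ,
  (h₁ , from (⊨-shift A h₁) TA) , (h₀ , from (⊨-shift B h₀) TB)
  where
  h₁ = ∩head-headed T true
  h₀ = ∩head-headed T false

disj : Sig → Formula n → Formula n → Formula n
disj laxΣ    = _∨'_
disj strictΣ = _∨̇'_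

⊨-disj⇒∨ : ∀ σ {T : Team n} (φ ψ : Formula n) → T ⊨ disj σ φ ψ → T ⊨ (φ ∨' ψ)
⊨-disj⇒∨ laxΣ    φ ψ h                      = h
⊨-disj⇒∨ strictΣ φ ψ (S , U , (sp , _) , h) = S , U , sp , h

⊨-∨̇⇒disj : ∀ σ {T : Team n} (φ ψ : Formula n) → T ⊨ (φ ∨̇' ψ) → T ⊨ disj σ φ ψ
⊨-∨̇⇒disj laxΣ    φ ψ (S , U , (sp , _) , h) = S , U , sp , h
⊨-∨̇⇒disj strictΣ φ ψ h                      = h

byHead : Sig → Formula n → Formula n → Formula (suc n)
byHead σ A B = disj σ (branch true A) (branch false B)

-- The lax split suffices for ⇒ and the canonical strict split witnesses ⇐, so σ is irrelevant.
⊨-byHead : ∀ σ {T : Team (suc n)} (A B : Formula n) → T ⊨ byHead σ A B ⇔ (T ↾ true ⊨ A × T ↾ false ⊨ B)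
⊨-byHead σ A B = mk⇔ (branches-⊨ A B ∘ ⊨-disj⇒∨ σ _ _) (⊨-∨̇⇒disj σ _ _ ∘ uncurry (⊨-branches A B))

countTrue-++ : (T : Team n) (xs ys : List (Assignment n)) →
               countTrue T (xs ++ ys) ≡ countTrue T xs + countTrue T ys
countTrue-++ T []       ys = refl
countTrue-++ T (x ∷ xs) ys with T x
... | true  = cong suc (countTrue-++ T xs ys)
... | false = countTrue-++ T xs ys

countTrue-map-∷ : (T : Team (suc n)) (b : Bool) (xs : List (Assignment n)) →
                  countTrue T (map (b ∷_) xs) ≡ countTrue (T ↾ b) xs
countTrue-map-∷ T b []       = refl
countTrue-map-∷ T b (x ∷ xs) with T (b ∷ x)
... | true  = cong suc (countTrue-map-∷ T b xs)
... | false = countTrue-map-∷ T b xs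

card-↾ : (T : Team (suc n)) → card T ≡ card (T ↾ true) + card (T ↾ false)
card-↾ {n} T = trans (countTrue-++ T (map (true ∷_) ss) (map (false ∷_) ss))
                     (cong₂ _+_ (countTrue-map-∷ T true ss) (countTrue-map-∷ T false ss))
  where ss = allAssignments n

parity : ℕ → Bool
parity zero    = false
parity (suc m) = not (parity m)

parity-+ : ∀ m m' → parity (m + m') ≡ parity m xor parity m'
parity-+ zero    m' = refl
parity-+ (suc m) m' = trans (cong not (parity-+ m m')) (not-distribˡ-xor (parity m) (parity m'))

parity-card₀ : (T : Team 0) → parity (card T) ≡ T []
parity-card₀ T with T []
... | true  = refl
... | false = refl

bit : Bool → ℕ
bit b = if b then 1 else 0

%2≡bit-parity : ∀ m → m % 2 ≡ bit (parity m)
%2≡bit-parity 0             = refl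
%2≡bit-parity 1             = refl
%2≡bit-parity (suc (suc m)) = trans (%2≡bit-parity m) (cong bit (sym (not-involutive (parity m))))

bit-injective : ∀ {x y} → bit x ≡ bit y → x ≡ y
bit-injective {true}  {true}  _ = refl
bit-injective {false} {false} _ = refl

%2≡bit⇔parity≡ : ∀ m → m % 2 ≡ bit b ⇔ parity m ≡ b
%2≡bit⇔parity≡ m = mk⇔ (λ e → bit-injective (trans (sym (%2≡bit-parity m)) e))
                       (λ e → trans (%2≡bit-parity m) (cong bit e))

xor≡⇔ : ∀ {x y} → x xor y ≡ b ⇔ ((x ≡ true × y ≡ true xor b) ⊎ (x ≡ false × y ≡ false xor b))
xor≡⇔ = mk⇔ split join
  where
  split : ∀ {x y b} → x xor y ≡ b → (x ≡ true × y ≡ true xor b) ⊎ (x ≡ false × y ≡ false xor b)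
  split {true}  {y} refl = inj₁ (refl , sym (not-involutive y))
  split {false}     refl = inj₂ (refl , refl)
  join : ∀ {x y b} → (x ≡ true × y ≡ true xor b) ⊎ (x ≡ false × y ≡ false xor b) → x xor y ≡ b
  join {b = b} (inj₁ (refl , refl)) = not-involutive b
  join         (inj₂ (refl , refl)) = refl

parityFormula : Sig → (n : ℕ) → Bool → Formula n
parityFormula σ zero    true  = lit (tilde bot)
parityFormula σ zero    false = lit (plain bot)
parityFormula σ (suc n) b     = byHead σ (P true) (P (true xor b)) ⊻' byHead σ (P false) (P (false xor b))
  where P = parityFormula σ n

⊨-parityFormula₀ : ∀ σ (T : Team 0) → T ⊨ parityFormula σ 0 b ⇔ T [] ≡ b
⊨-parityFormula₀ {b = true}  σ T = mk⇔ (λ h → ¬-not (λ e → h λ { [] → e })) (λ e h → not-¬ e (h []))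
⊨-parityFormula₀ {b = false} σ T = mk⇔ (λ h → h []) (λ { e [] → e })

⊨-parityFormula : ∀ σ n b (T : Team n) → T ⊨ parityFormula σ n b ⇔ parity (card T) ≡ b
⊨-parityFormula σ zero b T = begin
  T ⊨ parityFormula σ 0 b  ≈⟨ ⊨-parityFormula₀ σ T ⟩
  T [] ≡ b                 ≡⟨ cong (_≡ b) (parity-card₀ T) ⟨
  parity (card T) ≡ b      ∎
  where open ≈-Reasoning (⇔-setoid 0ℓ)
⊨-parityFormula σ (suc n) b T = begin
  T ⊨ parityFormula σ (suc n) b
    ≈⟨ ⊨-byHead σ _ _ ⊎-⇔ ⊨-byHead σ _ _ ⟩
  ((T ↾ true ⊨ P true × T ↾ false ⊨ P (true xor b)) ⊎ (T ↾ true ⊨ P false × T ↾ false ⊨ P (false xor b)))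
    ≈⟨ (IH _ ×-⇔ IH _) ⊎-⇔ (IH _ ×-⇔ IH _) ⟩
  ((parity ct ≡ true × parity cf ≡ true xor b) ⊎ (parity ct ≡ false × parity cf ≡ false xor b))
    ≈⟨ xor≡⇔ ⟨
  parity ct xor parity cf ≡ b
    ≡⟨ cong (_≡ b) (trans (cong parity (card-↾ T)) (parity-+ ct cf)) ⟨
  parity (card T) ≡ b
    ∎
  where
  open ≈-Reasoning (⇔-setoid 0ℓ)
  P = parityFormula σ n
  IH : ∀ {c} c' → (T ↾ c) ⊨ P c' ⇔ parity (card (T ↾ c)) ≡ c'
  IH c' = ⊨-parityFormula σ n c' _
  ct = card (T ↾ true)
  cf = card (T ↾ false)

parityFormula-defines : ∀ σ n b → Defines (parityFormula σ n b) (λ T → card T % 2 ≡ bit b)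
parityFormula-defines σ n b T =
  from (%2≡bit⇔parity≡ (card T)) ∘ to (⊨-parityFormula σ n b T) ,
  from (⊨-parityFormula σ n b T) ∘ to (%2≡bit⇔parity≡ (card T))

InPL-shift : ∀ σ (φ : Formula n) → InPL σ φ → InPL σ (shift φ)
InPL-shift σ       (lit (plain a)) _       = tt
InPL-shift σ       (lit (tilde a)) _       = tt
InPL-shift σ       (φ ∧' ψ)        (p , q) = InPL-shift σ φ p , InPL-shift σ ψ q
InPL-shift σ       (φ ⊻' ψ)        (p , q) = InPL-shift σ φ p , InPL-shift σ ψ q
InPL-shift laxΣ    (φ ∨' ψ)        (p , q) = InPL-shift laxΣ φ p , InPL-shift laxΣ ψ q
InPL-shift strictΣ (φ ∨̇' ψ)        (p , q) = InPL-shift strictΣ φ p , InPL-shift strictΣ ψ q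

InPL-disj : ∀ σ {φ ψ : Formula n} → InPL σ φ → InPL σ ψ → InPL σ (disj σ φ ψ)
InPL-disj laxΣ    p q = p , q
InPL-disj strictΣ p q = p , q

InPL-byHead : ∀ σ {A B : Formula n} → InPL σ A → InPL σ B → InPL σ (byHead σ A B)
InPL-byHead σ {A} {B} p q = InPL-disj σ (tt , InPL-shift σ A p) (tt , InPL-shift σ B q)

InPL-parityFormula : ∀ σ n b → InPL σ (parityFormula σ n b)
InPL-parityFormula σ zero    true  = tt
InPL-parityFormula σ zero    false = tt
InPL-parityFormula σ (suc n) b     =
  InPL-byHead σ (IH true) (IH (true xor b)) , InPL-byHead σ (IH false) (IH (false xor b))
  where IH = InPL-parityFormula σ n

len-shiftᵃ : (a : Atom n) → atomLen (shiftᵃ a) ≡ atomLen a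
len-shiftᵃ top     = refl
len-shiftᵃ bot     = refl
len-shiftᵃ (pos i) = refl
len-shiftᵃ (neg i) = refl

len-shift : (φ : Formula n) → len (shift φ) ≡ len φ
len-shift (lit (plain a)) = len-shiftᵃ a
len-shift (lit (tilde a)) = cong suc (len-shiftᵃ a)
len-shift (φ ∧' ψ)        = cong₂ (λ x y → x + y + 3) (len-shift φ) (len-shift ψ)
len-shift (φ ⊻' ψ)        = cong₂ (λ x y → x + y + 3) (len-shift φ) (len-shift ψ)
len-shift (φ ∨' ψ)        = cong₂ (λ x y → x + y + 3) (len-shift φ) (len-shift ψ)
len-shift (φ ∨̇' ψ)        = cong₂ (λ x y → x + y + 3) (len-shift φ) (len-shift ψ)

len-disj : ∀ σ (φ ψ : Formula n) → len (disj σ φ ψ) ≡ len φ + len ψ + 3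
len-disj laxΣ    φ ψ = refl
len-disj strictΣ φ ψ = refl

len-byHead : ∀ σ (A B : Formula n) → len (byHead σ A B) ≡ len A + len B + 12
len-byHead σ A B rewrite len-disj σ (branch true A) (branch false B) | len-shift A | len-shift B =
  regroup (len A) (len B)
  where
  regroup : ∀ a b → 1 + a + 3 + (2 + b + 3) + 3 ≡ a + b + 12
  regroup = solve-∀

-- len + 9 is multiplied by exactly 4 from one level to the next.
len-parityFormula : ∀ σ n b → len (parityFormula σ n b) + 9 ≤ 11 * 4 ^ n
len-parityFormula σ zero    true  = ≤-refl
len-parityFormula σ zero    false = n≤1+n 10
len-parityFormula σ (suc n) b     = begin
  len (parityFormula σ (suc n) b) + 9
    ≡⟨ cong₂ (λ x y → x + y + 3 + 9) (len-byHead σ _ _) (len-byHead σ _ _) ⟩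
  l₁ + l₂ + 12 + (l₃ + l₄ + 12) + 3 + 9
    ≡⟨ regroup l₁ l₂ l₃ l₄ ⟩
  (l₁ + 9) + (l₂ + 9) + (l₃ + 9) + (l₄ + 9)
    ≤⟨ +-mono-≤ (+-mono-≤ (+-mono-≤ (IH _) (IH _)) (IH _)) (IH _) ⟩
  11 * 4 ^ n + 11 * 4 ^ n + 11 * 4 ^ n + 11 * 4 ^ n
    ≡⟨ fourfold (4 ^ n) ⟩
  11 * 4 ^ suc n
    ∎
  where
  open ≤-Reasoning
  IH = len-parityFormula σ n
  l₁ = len (parityFormula σ n true)
  l₂ = len (parityFormula σ n (true xor b))
  l₃ = len (parityFormula σ n false)
  l₄ = len (parityFormula σ n (false xor b))
  regroup : ∀ a b c d → a + b + 12 + (c + d + 12) + 3 + 9 ≡ (a + 9) + (b + 9) + (c + 9) + (d + 9)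
  regroup = solve-∀
  fourfold : ∀ x → 11 * x + 11 * x + 11 * x + 11 * x ≡ 11 * (4 * x)
  fourfold = solve-∀

len-parityFormula≤ : ∀ σ n b → len (parityFormula σ n b) ≤ 11 * 2 ^ (2 * n)
len-parityFormula≤ σ n b = m+n≤o⇒m≤o _
  (≤-trans (len-parityFormula σ n b) (≤-reflexive (cong (11 *_) (^-*-assoc 2 2 n))))

theorem4p12 : (σ : Sig) → Σ ℕ λ C → Σ ℕ λ c → (n : ℕ) →
    (Σ (Formula n) λ φ → InPL σ φ × len φ ≤ C * 2 ^ (c * n) × Defines φ OddCard) ×
    (Σ (Formula n) λ φ → InPL σ φ × len φ ≤ C * 2 ^ (c * n) × Defines φ EvenCard)
theorem4p12 σ = 11 , 2 , λ n → parityDefinable n true , parityDefinable n false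
  where
  parityDefinable : ∀ n b → Σ (Formula n) λ φ →
    InPL σ φ × len φ ≤ 11 * 2 ^ (2 * n) × Defines φ (λ T → card T % 2 ≡ bit b)
  parityDefinable n b = parityFormula σ n b , InPL-parityFormula σ n b ,
                        len-parityFormula≤ σ n b , parityFormula-defines σ n b
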